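{- Let $F$ be a field and $A$ a finite-dimensional simple associative $F$-algebra with identity. Then no $F$-subspace $H$ of $A$ of codimension one satisfies $U(A) \subseteq H$.
   Context: $U(A)$ denotes the set of elements of $A$ having a two-sided multiplicative inverse. -}

module Defs where

open import Level using (Level; _⊔_) renaming (suc to lsuc)
open import Algebra.Bundles using (CommutativeRing; Ring)
open import Data.Nat using (ℕ; zero; suc)
open import Data.Fin using (Fin; zero; suc)
open import Data.Product using (Σ; ∃; _×_; _,_)
open import Relation.Nullary using (¬_)
open import Relation.Unary using (Pred)

record Field (c ℓ : Level) : Set (lsuc (c ⊔ ℓ)) where
  field
    commutativeRing : CommutativeRing c ℓ
  open CommutativeRing commutativeRing public
  field
    1≉0     : ¬ (1# ≈ 0#)
    inverse : ∀ x → ¬ (x ≈ 0#) → ∃ λ y → (x * y) ≈ 1#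

record FAlgebra {c ℓ : Level} (F : Field c ℓ) (a ℓa : Level) : Set (lsuc (c ⊔ ℓ ⊔ a ⊔ ℓa)) where
  module K = Field F
  field
    ring : Ring a ℓa
  open Ring ring public hiding (zero)
  infixr 7 _·_
  field
    _·_       : K.Carrier → Carrier → Carrier
    ·-cong    : ∀ {λ₁ λ₂ x y} → λ₁ K.≈ λ₂ → x ≈ y → (λ₁ · x) ≈ (λ₂ · y)
    ·-distribʳ : ∀ λ₁ λ₂ x → ((λ₁ K.+ λ₂) · x) ≈ ((λ₁ · x) + (λ₂ · x))
    ·-distribˡ : ∀ λ₁ x y → (λ₁ · (x + y)) ≈ ((λ₁ · x) + (λ₁ · y))
    ·-assoc   : ∀ λ₁ λ₂ x → ((λ₁ K.* λ₂) · x) ≈ (λ₁ · (λ₂ · x))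
    ·-identity : ∀ x → (K.1# · x) ≈ x
    ·-*-assocˡ : ∀ λ₁ x y → ((λ₁ · x) * y) ≈ (λ₁ · (x * y))
    ·-*-assocʳ : ∀ λ₁ x y → (x * (λ₁ · y)) ≈ (λ₁ · (x * y))

module _ {c ℓ a ℓa : Level} {F : Field c ℓ} (A : FAlgebra F a ℓa) where
  open FAlgebra A

  lincomb : ∀ n → (Fin n → K.Carrier) → (Fin n → Carrier) → Carrier
  lincomb zero    cs bs = 0#
  lincomb (suc n) cs bs = (cs zero · bs zero) + lincomb n (λ i → cs (suc i)) (λ i → bs (suc i))

  IsBasis : ∀ n → (Fin n → Carrier) → Set (c ⊔ ℓ ⊔ a ⊔ ℓa)
  IsBasis n b =
    (∀ x → ∃ λ (cs : Fin n → K.Carrier) → x ≈ lincomb n cs b) ×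
    (∀ (cs : Fin n → K.Carrier) → lincomb n cs b ≈ 0# → ∀ i → cs i K.≈ K.0#)

  FiniteDimensional : Set (c ⊔ ℓ ⊔ a ⊔ ℓa)
  FiniteDimensional = ∃ λ n → Σ (Fin n → Carrier) (IsBasis n)

  record IsIdeal {ℓi : Level} (I : Pred Carrier ℓi) : Set (a ⊔ ℓa ⊔ ℓi) where
    field
      resp  : ∀ {x y} → x ≈ y → I x → I y
      zero∈ : I 0#
      +∈    : ∀ {x y} → I x → I y → I (x + y)
      *ˡ∈   : ∀ r {x} → I x → I (r * x)
      *ʳ∈   : ∀ r {x} → I x → I (x * r)

  IsSimple : Set (lsuc (c ⊔ ℓ ⊔ a ⊔ ℓa))
  IsSimple = ¬ (1# ≈ 0#) ×
    (∀ (I : Pred Carrier (c ⊔ ℓ ⊔ a ⊔ ℓa)) → IsIdeal I →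
       (∃ λ x → I x × ¬ (x ≈ 0#)) → ∀ y → I y)

  record IsSubspace {ℓh : Level} (H : Pred Carrier ℓh) : Set (c ⊔ a ⊔ ℓa ⊔ ℓh) where
    field
      resp  : ∀ {x y} → x ≈ y → H x → H y
      zero∈ : H 0#
      +∈    : ∀ {x y} → H x → H y → H (x + y)
      ·∈    : ∀ λ₁ {x} → H x → H (λ₁ · x)

  -- H has codimension one: A/H is one-dimensional, i.e. there is w ∉ H whose class spans A/H
  HasCodimOne : {ℓh : Level} → Pred Carrier ℓh → Set (c ⊔ a ⊔ ℓh)
  HasCodimOne H = ∃ λ w → ¬ H w × (∀ x → ∃ λ (λ₁ : K.Carrier) → H (x - (λ₁ · w)))

  IsUnit : Carrier → Set (a ⊔ ℓa)
  IsUnit u = ∃ λ v → ((u * v) ≈ 1#) × ((v * u) ≈ 1#)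

{-# OPTIONS --safe #-}
module Submission where

-- The units of A span A, so no proper subspace contains them.  Since A is finite-dimensional,
-- every x satisfies a nonzero polynomial; splitting off its lowest term gives x^k = x^(k+1) b
-- with b commuting with x.  Then e = x^k b^k is an idempotent commuting with x, and with
-- f = 1 - e the element x e + f is a unit (inverse b e + f) while f x is nilpotent, so that
-- 1 - f x is a unit.  Hence x = (x e + f) - f + f x lies in the span once f does.
-- Every idempotent e lies in the span: if e ≠ 1, the two-sided ideal {y | e A y A e ⊆ span U(A)}
-- contains f = 1 - e ≠ 0, as e p f q e = (e p f)(f q e) is a product of square-zero elements;
-- by simplicity it contains 1, and e = e 1 1 1 e.
-- Equality in F is not decidable, so these case distinctions take place in the double-negation
-- monad, which suffices because the theorem is a negation.

open import Defs
open import Level using (Level; _⊔_)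
open import Data.Nat using (ℕ; zero; suc)
open import Data.Fin using (Fin; zero; suc; toℕ; punchIn)
open import Data.Product using (∃; ∃₂; _×_; _,_; proj₁; proj₂)
open import Data.Sum using (_⊎_; inj₁; inj₂)
open import Data.Vec.Functional using (_∷_; insertAt; removeAt)
open import Data.Vec.Functional.Properties using (insertAt-lookup; insertAt-punchIn)
open import Function using (_∘_)
open import Relation.Nullary using (¬_; yes; no)
open import Relation.Nullary.Negation using (¬¬-map; negated-stable; contradiction)
open import Relation.Nullary.Decidable using (¬¬-excluded-middle)
open import Relation.Unary using (Pred)
import Relation.Binary.PropositionalEquality as ≡
import Algebra.Properties.Ring as RingProperties
import Algebra.Properties.Group as GroupProperties
import Algebra.Properties.Semiring.Sum as SemiringSum
import Algebra.Properties.Semiring.Exp as SemiringExp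
import Relation.Binary.Reasoning.Setoid as SetoidReasoning

private
  variable
    p : Level
    P Q : Set p

  return : P → ¬ ¬ P
  return x ¬x = ¬x x

  _>>=_ : ¬ ¬ P → (P → ¬ ¬ Q) → ¬ ¬ Q
  m >>= f = negated-stable (¬¬-map f m)

¬¬-∀⊎∃¬ : ∀ m (P : Pred (Fin m) p) → ¬ ¬ ((∀ i → P i) ⊎ ∃ λ i → ¬ P i)
¬¬-∀⊎∃¬ zero    P = return (inj₁ λ ())
¬¬-∀⊎∃¬ (suc m) P = ¬¬-excluded-middle >>= λ
  { (no ¬P₀) → return (inj₂ (zero , ¬P₀))
  ; (yes P₀) → ¬¬-map (extend P₀) (¬¬-∀⊎∃¬ m (P ∘ suc)) }
  where
  extend : P zero → (∀ i → P (suc i)) ⊎ (∃ λ i → ¬ P (suc i)) → (∀ i → P i) ⊎ (∃ λ i → ¬ P i)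
  extend P₀ (inj₁ Pₛ)       = inj₁ λ { zero → P₀ ; (suc i) → Pₛ i }
  extend P₀ (inj₂ (i , ¬P)) = inj₂ (suc i , ¬P)

module _ {c ℓ a ℓa : Level} {F : Field c ℓ} (A : FAlgebra F a ℓa) where
  open FAlgebra A
  open RingProperties ring
    using (x+x≈x⇒x≈0; -‿distribˡ-*; -‿distribʳ-*; x[y-z]≈xy-xz; [y-z]x≈yx-zx)
  open GroupProperties +-group
    using (inverseˡ-unique; inverseʳ-unique; ε⁻¹≈ε; x∙y⁻¹≈ε⇒x≈y; //-rightDividesˡ; //-rightDividesʳ)
  open SemiringSum semiring
    using (sum; sum-syntax; sum-cong-≋; sum-cong-≗; sum-remove; ∑-distrib-+; *-distribˡ-sum)
  open SemiringExp semiring using (_^_; y*x^m*y^n≈x^m*y^[n+1])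
  module K∑ = SemiringSum K.semiring
  open SetoidReasoning setoid

  ·-zeroʳ : ∀ r → r · 0# ≈ 0#
  ·-zeroʳ r = x+x≈x⇒x≈0 (r · 0#)
    (trans (sym (·-distribˡ r 0# 0#)) (·-cong K.refl (+-identityʳ 0#)))

  ·-zeroˡ : ∀ x → K.0# · x ≈ 0#
  ·-zeroˡ x = x+x≈x⇒x≈0 (K.0# · x)
    (trans (sym (·-distribʳ K.0# K.0# x)) (·-cong (K.+-identityʳ K.0#) refl))

  -‿distribˡ-· : ∀ r x → (K.- r) · x ≈ - (r · x)
  -‿distribˡ-· r x = inverseʳ-unique (r · x) ((K.- r) · x)
    (trans (sym (·-distribʳ r (K.- r) x)) (trans (·-cong (K.-‿inverseʳ r) refl) (·-zeroˡ x)))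

  ·-distribˡ-sum : ∀ r {n} (xs : Fin n → Carrier) → r · sum xs ≈ ∑[ i < n ] (r · xs i)
  ·-distribˡ-sum r {zero}  xs = ·-zeroʳ r
  ·-distribˡ-sum r {suc n} xs = trans (·-distribˡ r _ _) (+-congˡ (·-distribˡ-sum r (xs ∘ suc)))

  ·-distribʳ-sum : ∀ {n} (rs : Fin n → K.Carrier) x → K∑.sum rs · x ≈ ∑[ i < n ] (rs i · x)
  ·-distribʳ-sum {zero}  rs x = ·-zeroˡ x
  ·-distribʳ-sum {suc n} rs x = trans (·-distribʳ _ _ x) (+-congˡ (·-distribʳ-sum (rs ∘ suc) x))

  lincomb≡sum : ∀ n cs xs → lincomb A n cs xs ≡.≡ ∑[ i < n ] (cs i · xs i)
  lincomb≡sum zero    cs xs = ≡.refl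
  lincomb≡sum (suc n) cs xs = ≡.cong (cs zero · xs zero +_) (lincomb≡sum n (cs ∘ suc) (xs ∘ suc))

  Commute : Carrier → Carrier → Set ℓa
  Commute x y = x * y ≈ y * x

  commute-0ʳ : ∀ x → Commute x 0#
  commute-0ʳ x = trans (zeroʳ x) (sym (zeroˡ x))

  commute-1ʳ : ∀ x → Commute x 1#
  commute-1ʳ x = trans (*-identityʳ x) (sym (*-identityˡ x))

  commute-+ʳ : ∀ {x y z} → Commute x y → Commute x z → Commute x (y + z)
  commute-+ʳ {x} {y} {z} xy xz = begin
    x * (y + z)     ≈⟨ distribˡ x y z ⟩
    x * y + x * z   ≈⟨ +-cong xy xz ⟩
    y * x + z * x   ≈⟨ distribʳ x y z ⟨
    (y + z) * x     ∎

  commute-‿ʳ : ∀ {x y} → Commute x y → Commute x (- y)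
  commute-‿ʳ {x} {y} xy = begin
    x * - y     ≈⟨ -‿distribʳ-* x y ⟨
    - (x * y)   ≈⟨ -‿cong xy ⟩
    - (y * x)   ≈⟨ -‿distribˡ-* y x ⟩
    - y * x     ∎

  commute-*ʳ : ∀ {x y z} → Commute x y → Commute x z → Commute x (y * z)
  commute-*ʳ {x} {y} {z} xy xz = begin
    x * (y * z)   ≈⟨ *-assoc x y z ⟨
    x * y * z     ≈⟨ *-congʳ xy ⟩
    y * x * z     ≈⟨ *-assoc y x z ⟩
    y * (x * z)   ≈⟨ *-congˡ xz ⟩
    y * (z * x)   ≈⟨ *-assoc y z x ⟨
    y * z * x     ∎

  commute-·ʳ : ∀ {x y} r → Commute x y → Commute x (r · y)
  commute-·ʳ {x} {y} r xy = begin
    x * (r · y)   ≈⟨ ·-*-assocʳ r x y ⟩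
    r · (x * y)   ≈⟨ ·-cong K.refl xy ⟩
    r · (y * x)   ≈⟨ ·-*-assocˡ r y x ⟨
    (r · y) * x   ∎

  commute-^ʳ : ∀ {x y} → Commute x y → ∀ n → Commute x (y ^ n)
  commute-^ʳ {x} xy zero    = commute-1ʳ x
  commute-^ʳ     xy (suc n) = commute-*ʳ xy (commute-^ʳ xy n)

  commute-sumʳ : ∀ {x n} {ys : Fin n → Carrier} → (∀ i → Commute x (ys i)) → Commute x (sum ys)
  commute-sumʳ {x} {zero}  xys = commute-0ʳ x
  commute-sumʳ {x} {suc n} xys = commute-+ʳ (xys zero) (commute-sumʳ (xys ∘ suc))

  Nontrivial : ∀ {m} → (Fin m → K.Carrier) → Set ℓ
  Nontrivial ds = ∃ λ i → ¬ ds i K.≈ K.0#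

  LinearlyDependent : ∀ {m} → (Fin m → Carrier) → Set (c ⊔ ℓ ⊔ ℓa)
  LinearlyDependent {m} v = ∃ λ ds → Nontrivial ds × ∑[ i < m ] (ds i · v i) ≈ 0#

  tail-dependent⇒dependent : ∀ {m} {v : Fin (suc m) → Carrier} →
    LinearlyDependent (v ∘ suc) → LinearlyDependent v
  tail-dependent⇒dependent {v = v} (ds , (i , dsᵢ≉0) , ∑≈0) =
    K.0# ∷ ds , (suc i , dsᵢ≉0) , trans (+-cong (·-zeroˡ (v zero)) ∑≈0) (+-identityʳ 0#)

  eliminated-dependent⇒dependent : ∀ {m} (v : Fin (suc m) → Carrier) k (r : Fin m → K.Carrier) →
    LinearlyDependent (λ i → removeAt v k i + r i · v k) → LinearlyDependent v
  eliminated-dependent⇒dependent {m} v k r (ds , (i , dsᵢ≉0) , ∑≈0) =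
    insertAt ds k s , (punchIn k i , ≡.subst (λ d → ¬ d K.≈ K.0#) (≡.sym (insertAt-punchIn ds k s i)) dsᵢ≉0)
    , ∑≈0′
    where
    s : K.Carrier
    s = K∑.sum (λ j → ds j K.* r j)
    ∑≈0′ : ∑[ j < suc m ] (insertAt ds k s j · v j) ≈ 0#
    ∑≈0′ = begin
      ∑[ j < suc m ] (insertAt ds k s j · v j)
        ≈⟨ sum-remove {i = k} (λ j → insertAt ds k s j · v j) ⟩
      insertAt ds k s k · v k + ∑[ j < m ] (insertAt ds k s (punchIn k j) · removeAt v k j)
        ≡⟨ ≡.cong₂ _+_ (≡.cong (_· v k) (insertAt-lookup ds k s))
                       (sum-cong-≗ λ j → ≡.cong (_· removeAt v k j) (insertAt-punchIn ds k s j)) ⟩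
      s · v k + ∑[ j < m ] (ds j · removeAt v k j)
        ≈⟨ +-comm _ _ ⟩
      ∑[ j < m ] (ds j · removeAt v k j) + s · v k
        ≈⟨ +-congˡ (·-distribʳ-sum (λ j → ds j K.* r j) (v k)) ⟩
      ∑[ j < m ] (ds j · removeAt v k j) + ∑[ j < m ] ((ds j K.* r j) · v k)
        ≈⟨ ∑-distrib-+ (λ j → ds j · removeAt v k j) (λ j → (ds j K.* r j) · v k) ⟨
      ∑[ j < m ] (ds j · removeAt v k j + (ds j K.* r j) · v k)
        ≈⟨ sum-cong-≋ (λ j → +-congˡ (·-assoc (ds j) (r j) (v k))) ⟩
      ∑[ j < m ] (ds j · removeAt v k j + ds j · (r j · v k))
        ≈⟨ sum-cong-≋ (λ j → ·-distribˡ (ds j) _ _) ⟨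
      ∑[ j < m ] (ds j · (removeAt v k j + r j · v k))
        ≈⟨ ∑≈0 ⟩
      0# ∎

  private
    module Elimination {n} (ys : Fin (suc n) → Carrier) (v : Fin (suc (suc n)) → Carrier)
      (cs : Fin (suc (suc n)) → Fin (suc n) → K.Carrier)
      (v≈ : ∀ i → v i ≈ ∑[ l < suc n ] (cs i l · ys l))
      (k : Fin (suc (suc n))) (pivot≉0 : ¬ cs k zero K.≈ K.0#) where

      open RingProperties K.ring using () renaming (-‿distribˡ-* to K-‿distribˡ-*)

      pivot⁻¹ : K.Carrier
      pivot⁻¹ = proj₁ (K.inverse (cs k zero) pivot≉0)

      r : Fin (suc n) → K.Carrier
      r i = K.- (cs (punchIn k i) zero K.* pivot⁻¹)

      cs′ : Fin (suc n) → Fin n → K.Carrier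
      cs′ i l = cs (punchIn k i) (suc l) K.+ r i K.* cs k (suc l)

      pivot-cancels : ∀ i → cs (punchIn k i) zero K.+ r i K.* cs k zero K.≈ K.0#
      pivot-cancels i = K.trans (K.+-congˡ r·pivot≈-c) (K.-‿inverseʳ cᵢ)
        where
        cᵢ : K.Carrier
        cᵢ = cs (punchIn k i) zero
        pivot⁻¹·pivot≈1 : pivot⁻¹ K.* cs k zero K.≈ K.1#
        pivot⁻¹·pivot≈1 = K.trans (K.*-comm _ _) (proj₂ (K.inverse (cs k zero) pivot≉0))
        r·pivot≈-c : r i K.* cs k zero K.≈ K.- cᵢ
        r·pivot≈-c = K.trans (K.sym (K-‿distribˡ-* _ _)) (K.-‿cong
          (K.trans (K.*-assoc cᵢ pivot⁻¹ _) (K.trans (K.*-congˡ pivot⁻¹·pivot≈1) (K.*-identityʳ cᵢ))))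

      eliminated≈ : ∀ i → removeAt v k i + r i · v k ≈ ∑[ l < n ] (cs′ i l · ys (suc l))
      eliminated≈ i = begin
        v (punchIn k i) + r i · v k
          ≈⟨ +-cong (v≈ (punchIn k i)) (·-cong K.refl (v≈ k)) ⟩
        ∑[ l < suc n ] (cs (punchIn k i) l · ys l) + r i · ∑[ l < suc n ] (cs k l · ys l)
          ≈⟨ +-congˡ (·-distribˡ-sum (r i) (λ l → cs k l · ys l)) ⟩
        ∑[ l < suc n ] (cs (punchIn k i) l · ys l) + ∑[ l < suc n ] (r i · (cs k l · ys l))
          ≈⟨ ∑-distrib-+ (λ l → cs (punchIn k i) l · ys l) (λ l → r i · (cs k l · ys l)) ⟨
        ∑[ l < suc n ] (cs (punchIn k i) l · ys l + r i · (cs k l · ys l))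
          ≈⟨ sum-cong-≋ (λ l → trans (·-distribʳ (cs (punchIn k i) l) (r i K.* cs k l) (ys l))
                                      (+-congˡ (·-assoc (r i) (cs k l) (ys l)))) ⟨
        (cs (punchIn k i) zero K.+ r i K.* cs k zero) · ys zero + ∑[ l < n ] (cs′ i l · ys (suc l))
          ≈⟨ +-congʳ (trans (·-cong (pivot-cancels i) refl) (·-zeroˡ (ys zero))) ⟩
        0# + ∑[ l < n ] (cs′ i l · ys (suc l))
          ≈⟨ +-identityˡ _ ⟩
        ∑[ l < n ] (cs′ i l · ys (suc l)) ∎

  spanned-by-fewer⇒¬¬dependent : ∀ n (ys : Fin n → Carrier) (v : Fin (suc n) → Carrier)
    (cs : Fin (suc n) → Fin n → K.Carrier) → (∀ i → v i ≈ ∑[ l < n ] (cs i l · ys l)) →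
    ¬ ¬ LinearlyDependent v
  spanned-by-fewer⇒¬¬dependent zero ys v cs v≈ =
    return ((λ _ → K.1#) , (zero , K.1≉0) , trans (+-identityʳ _) (trans (·-identity (v zero)) (v≈ zero)))
  spanned-by-fewer⇒¬¬dependent (suc n) ys v cs v≈ = ¬¬-∀⊎∃¬ _ (λ i → cs i zero K.≈ K.0#) >>= λ
    { (inj₁ cs₀≈0) → ¬¬-map (tail-dependent⇒dependent {v = v})
        (spanned-by-fewer⇒¬¬dependent n (ys ∘ suc) (v ∘ suc) (λ i l → cs (suc i) (suc l))
          λ i → trans (v≈ (suc i))
                  (trans (+-congʳ (trans (·-cong (cs₀≈0 (suc i)) refl) (·-zeroˡ _))) (+-identityˡ _)))
    ; (inj₂ (k , pivot≉0)) → let open Elimination ys v cs v≈ k pivot≉0 in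
        ¬¬-map (eliminated-dependent⇒dependent v k r)
          (spanned-by-fewer⇒¬¬dependent n (ys ∘ suc) (λ i → removeAt v k i + r i · v k)
            cs′ eliminated≈) }

  evalPoly : ∀ {N} → (Fin N → K.Carrier) → Carrier → Carrier
  evalPoly {N} ds x = ∑[ i < N ] (ds i · x ^ toℕ i)

  commute-evalPoly : ∀ {N} (ds : Fin N → K.Carrier) x → Commute x (evalPoly ds x)
  commute-evalPoly ds x = commute-sumʳ λ i → commute-·ʳ (ds i) (commute-^ʳ refl (toℕ i))

  ^-*-evalPoly : ∀ x m {N} (ds : Fin (suc N) → K.Carrier) →
    x ^ m * evalPoly ds x ≈ ds zero · x ^ m + x ^ suc m * evalPoly (ds ∘ suc) x
  ^-*-evalPoly x m {N} ds = begin
    x ^ m * (ds zero · 1# + ∑[ i < N ] (ds (suc i) · (x * x ^ toℕ i)))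
      ≈⟨ *-congˡ (+-congˡ (sum-cong-≋ λ i → ·-*-assocʳ (ds (suc i)) x _)) ⟨
    x ^ m * (ds zero · 1# + ∑[ i < N ] (x * (ds (suc i) · x ^ toℕ i)))
      ≈⟨ *-congˡ (+-congˡ (*-distribˡ-sum x (λ i → ds (suc i) · x ^ toℕ i))) ⟨
    x ^ m * (ds zero · 1# + x * q)
      ≈⟨ distribˡ (x ^ m) _ _ ⟩
    x ^ m * (ds zero · 1#) + x ^ m * (x * q)
      ≈⟨ +-cong (·-*-assocʳ (ds zero) (x ^ m) 1#) (sym (*-assoc (x ^ m) x q)) ⟩
    ds zero · (x ^ m * 1#) + x ^ m * x * q
      ≈⟨ +-cong (·-cong K.refl (*-identityʳ (x ^ m))) (*-congʳ (sym (commute-^ʳ refl m))) ⟩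
    ds zero · x ^ m + x ^ suc m * q ∎
    where
    q : Carrier
    q = evalPoly (ds ∘ suc) x

  d·y+z≈0⇒y∈Fz : ∀ {d y z} → ¬ d K.≈ K.0# → d · y + z ≈ 0# → ∃ λ r → y ≈ r · z
  d·y+z≈0⇒y∈Fz {d} {y} {z} d≉0 d·y+z≈0 =
    K.- d⁻¹ , trans (inverseˡ-unique y (d⁻¹ · z) y+d⁻¹·z≈0) (sym (-‿distribˡ-· d⁻¹ z))
    where
    d⁻¹ : K.Carrier
    d⁻¹ = proj₁ (K.inverse d d≉0)
    d⁻¹·d≈1 : d⁻¹ K.* d K.≈ K.1#
    d⁻¹·d≈1 = K.trans (K.*-comm _ _) (proj₂ (K.inverse d d≉0))
    y+d⁻¹·z≈0 : y + d⁻¹ · z ≈ 0#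
    y+d⁻¹·z≈0 = begin
      y + d⁻¹ · z                 ≈⟨ +-congʳ (·-identity y) ⟨
      K.1# · y + d⁻¹ · z          ≈⟨ +-congʳ (·-cong d⁻¹·d≈1 refl) ⟨
      (d⁻¹ K.* d) · y + d⁻¹ · z   ≈⟨ +-congʳ (·-assoc d⁻¹ d y) ⟩
      d⁻¹ · (d · y) + d⁻¹ · z     ≈⟨ ·-distribˡ d⁻¹ (d · y) z ⟨
      d⁻¹ · (d · y + z)           ≈⟨ ·-cong K.refl d·y+z≈0 ⟩
      d⁻¹ · 0#                    ≈⟨ ·-zeroʳ d⁻¹ ⟩
      0#                          ∎

  Algebraic : Carrier → Set (c ⊔ ℓ ⊔ ℓa)
  Algebraic x = ∃₂ λ N (ds : Fin N → K.Carrier) → Nontrivial ds × evalPoly ds x ≈ 0#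

  finiteDimensional⇒¬¬algebraic : FiniteDimensional A → ∀ x → ¬ ¬ Algebraic x
  finiteDimensional⇒¬¬algebraic (n , bs , spans , _) x =
    ¬¬-map (suc n ,_) (spanned-by-fewer⇒¬¬dependent n bs (λ i → x ^ toℕ i) (proj₁ ∘ spans ∘ (x ^_) ∘ toℕ)
      λ i → trans (proj₂ (spans (x ^ toℕ i))) (reflexive (lincomb≡sum n _ bs)))

  StronglyπRegular : Carrier → Set (a ⊔ ℓa)
  StronglyπRegular x = ∃₂ λ k b → Commute x b × x ^ k ≈ x ^ suc k * b

  ^-*-annihilates⇒¬¬stronglyπRegular : ∀ x m {N} (ds : Fin N → K.Carrier) → Nontrivial ds →
    x ^ m * evalPoly ds x ≈ 0# → ¬ ¬ StronglyπRegular x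
  ^-*-annihilates⇒¬¬stronglyπRegular x m {suc N} ds (i , dsᵢ≉0) xᵐp≈0 = ¬¬-excluded-middle >>= λ
    { (yes ds₀≈0) → skip-zero-coefficient i ds₀≈0 dsᵢ≉0
    ; (no ds₀≉0) → let (r , xᵐ≈r·xᵐ⁺¹q) = d·y+z≈0⇒y∈Fz ds₀≉0 split in
        return (m , r · q , commute-·ʳ r (commute-evalPoly (ds ∘ suc) x)
               , trans xᵐ≈r·xᵐ⁺¹q (sym (·-*-assocʳ r _ q))) }
    where
    q : Carrier
    q = evalPoly (ds ∘ suc) x
    split : ds zero · x ^ m + x ^ suc m * q ≈ 0#
    split = trans (sym (^-*-evalPoly x m ds)) xᵐp≈0
    skip-zero-coefficient : ∀ i → ds zero K.≈ K.0# → ¬ ds i K.≈ K.0# → ¬ ¬ StronglyπRegular x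
    skip-zero-coefficient zero    ds₀≈0 ds₀≉0 = contradiction ds₀≈0 ds₀≉0
    skip-zero-coefficient (suc i) ds₀≈0 dsᵢ≉0 =
      ^-*-annihilates⇒¬¬stronglyπRegular x (suc m) (ds ∘ suc) (i , dsᵢ≉0)
        (trans (sym (+-identityˡ _)) (trans (+-congʳ (sym (trans (·-cong ds₀≈0 refl) (·-zeroˡ _)))) split))

  algebraic⇒¬¬stronglyπRegular : ∀ {x} → Algebraic x → ¬ ¬ StronglyπRegular x
  algebraic⇒¬¬stronglyπRegular {x} (N , ds , nontrivial , p≈0) =
    ^-*-annihilates⇒¬¬stronglyπRegular x 0 ds nontrivial (trans (*-identityˡ _) p≈0)

  commute⇒^-distrib-* : ∀ {x y} → Commute x y → ∀ n → (x * y) ^ n ≈ x ^ n * y ^ n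
  commute⇒^-distrib-* {x} {y} xy zero    = sym (*-identityˡ 1#)
  commute⇒^-distrib-* {x} {y} xy (suc n) = begin
    x * y * (x * y) ^ n       ≈⟨ *-congˡ (commute⇒^-distrib-* xy n) ⟩
    x * y * (x ^ n * y ^ n)   ≈⟨ *-assoc x y _ ⟩
    x * (y * (x ^ n * y ^ n)) ≈⟨ *-congˡ (y*x^m*y^n≈x^m*y^[n+1] xy n n) ⟩
    x * (x ^ n * y ^ suc n)   ≈⟨ *-assoc x _ _ ⟨
    x ^ suc n * y ^ suc n     ∎

  idempotent⇒^-suc : ∀ {e} → e * e ≈ e → ∀ n → e ^ suc n ≈ e
  idempotent⇒^-suc {e} e*e≈e zero    = *-identityʳ e
  idempotent⇒^-suc {e} e*e≈e (suc n) = trans (*-congˡ (idempotent⇒^-suc e*e≈e n)) e*e≈e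

  xy≈0⇒[yx]²≈0 : ∀ {x y} → x * y ≈ 0# → (y * x) ^ 2 ≈ 0#
  xy≈0⇒[yx]²≈0 {x} {y} xy≈0 = begin
    y * x * (y * x * 1#)   ≈⟨ *-congˡ (*-identityʳ _) ⟩
    y * x * (y * x)        ≈⟨ *-assoc y x _ ⟩
    y * (x * (y * x))      ≈⟨ *-congˡ (*-assoc x y x) ⟨
    y * (x * y * x)        ≈⟨ *-congˡ (*-congʳ xy≈0) ⟩
    y * (0# * x)           ≈⟨ *-congˡ (zeroˡ x) ⟩
    y * 0#                 ≈⟨ zeroʳ y ⟩
    0#                     ∎

  module Complement {e} (e*e≈e : e * e ≈ e) where

    f : Carrier
    f = 1# - e

    e+f≈1 : e + f ≈ 1#
    e+f≈1 = trans (+-comm e f) (//-rightDividesˡ e 1#)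

    e*f≈0 : e * f ≈ 0#
    e*f≈0 = trans (x[y-z]≈xy-xz e 1# e)
      (trans (+-cong (*-identityʳ e) (-‿cong e*e≈e)) (-‿inverseʳ e))

    f*e≈0 : f * e ≈ 0#
    f*e≈0 = trans ([y-z]x≈yx-zx e 1# e)
      (trans (+-cong (*-identityˡ e) (-‿cong e*e≈e)) (-‿inverseʳ e))

    f*f≈f : f * f ≈ f
    f*f≈f = begin
      (1# - e) * f     ≈⟨ [y-z]x≈yx-zx f 1# e ⟩
      1# * f - e * f   ≈⟨ +-cong (*-identityˡ f) (-‿cong e*f≈0) ⟩
      f - 0#           ≈⟨ +-congˡ ε⁻¹≈ε ⟩
      f + 0#           ≈⟨ +-identityʳ f ⟩
      f                ∎

    commute-complement : ∀ {x} → Commute x e → Commute x f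
    commute-complement {x} xe = commute-+ʳ (commute-1ʳ x) (commute-‿ʳ xe)

    corner-inverse : ∀ {u v} → Commute u e → Commute v e → u * v * e ≈ e →
                     (u * e + f) * (v * e + f) ≈ 1#
    corner-inverse {u} {v} ue ve uve≈e = begin
      (u * e + f) * (v * e + f)
        ≈⟨ distribʳ _ _ _ ⟩
      u * e * (v * e + f) + f * (v * e + f)
        ≈⟨ +-cong (distribˡ _ _ _) (distribˡ _ _ _) ⟩
      (u * e * (v * e) + u * e * f) + (f * (v * e) + f * f)
        ≈⟨ +-cong (+-cong ue·ve≈e ue·f≈0) (+-cong f·ve≈0 f*f≈f) ⟩
      (e + 0#) + (0# + f)
        ≈⟨ +-cong (+-identityʳ e) (+-identityˡ f) ⟩
      e + f
        ≈⟨ e+f≈1 ⟩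
      1# ∎
      where
      ue·ve≈e : u * e * (v * e) ≈ e
      ue·ve≈e = begin
        u * e * (v * e)   ≈⟨ *-assoc (u * e) v e ⟨
        u * e * v * e     ≈⟨ *-congʳ (*-assoc u e v) ⟩
        u * (e * v) * e   ≈⟨ *-congʳ (*-congˡ ve) ⟨
        u * (v * e) * e   ≈⟨ *-congʳ (*-assoc u v e) ⟨
        u * v * e * e     ≈⟨ *-assoc (u * v) e e ⟩
        u * v * (e * e)   ≈⟨ *-congˡ e*e≈e ⟩
        u * v * e         ≈⟨ uve≈e ⟩
        e                 ∎
      ue·f≈0 : u * e * f ≈ 0#
      ue·f≈0 = trans (*-assoc u e f) (trans (*-congˡ e*f≈0) (zeroʳ u))
      f·ve≈0 : f * (v * e) ≈ 0#
      f·ve≈0 = begin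
        f * (v * e)   ≈⟨ *-assoc f v e ⟨
        f * v * e     ≈⟨ *-congʳ (commute-complement ve) ⟨
        v * f * e     ≈⟨ *-assoc v f e ⟩
        v * (f * e)   ≈⟨ *-congˡ f*e≈0 ⟩
        v * 0#        ≈⟨ zeroʳ v ⟩
        0#            ∎

  isUnit-1 : IsUnit A 1#
  isUnit-1 = 1# , *-identityˡ 1# , *-identityˡ 1#

  isUnit-* : ∀ {x y} → IsUnit A x → IsUnit A y → IsUnit A (x * y)
  isUnit-* (x⁻¹ , xx⁻¹≈1 , x⁻¹x≈1) (y⁻¹ , yy⁻¹≈1 , y⁻¹y≈1) =
    y⁻¹ * x⁻¹ , cancel xx⁻¹≈1 yy⁻¹≈1 , cancel y⁻¹y≈1 x⁻¹x≈1
    where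
    cancel : ∀ {a b c d} → a * d ≈ 1# → b * c ≈ 1# → a * b * (c * d) ≈ 1#
    cancel {a} {b} {c} {d} ad≈1 bc≈1 = begin
      a * b * (c * d)   ≈⟨ *-assoc a b _ ⟩
      a * (b * (c * d)) ≈⟨ *-congˡ (*-assoc b c d) ⟨
      a * (b * c * d)   ≈⟨ *-congˡ (trans (*-congʳ bc≈1) (*-identityˡ d)) ⟩
      a * d             ≈⟨ ad≈1 ⟩
      1#                ∎

  data UnitSpan : Pred Carrier (c ⊔ ℓ ⊔ a ⊔ ℓa) where
    unit∈ : ∀ {u} → IsUnit A u → UnitSpan u
    +∈    : ∀ {x y} → UnitSpan x → UnitSpan y → UnitSpan (x + y)
    ·∈    : ∀ r {x} → UnitSpan x → UnitSpan (r · x)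
    resp  : ∀ {x y} → x ≈ y → UnitSpan x → UnitSpan y

  module _ {ℓh} {H : Pred Carrier ℓh} (H-subspace : IsSubspace A H)
           (units⊆H : ∀ u → IsUnit A u → H u) where
    private
      module H = IsSubspace H-subspace

    UnitSpan⊆ : ∀ {x} → UnitSpan x → H x
    UnitSpan⊆ (unit∈ u)     = units⊆H _ u
    UnitSpan⊆ (+∈ p q)      = H.+∈ (UnitSpan⊆ p) (UnitSpan⊆ q)
    UnitSpan⊆ (·∈ r p)      = H.·∈ r (UnitSpan⊆ p)
    UnitSpan⊆ (resp x≈y p) = H.resp x≈y (UnitSpan⊆ p)

  0∈ : UnitSpan 0#
  0∈ = resp (·-zeroˡ 1#) (·∈ K.0# (unit∈ isUnit-1))

  -∈ : ∀ {x} → UnitSpan x → UnitSpan (- x)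
  -∈ {x} p = resp (trans (-‿distribˡ-· K.1# x) (-‿cong (·-identity x))) (·∈ (K.- K.1#) p)

  ∈-cancelʳ : ∀ {x y} → UnitSpan (x + y) → UnitSpan y → UnitSpan x
  ∈-cancelʳ {x} {y} p q = resp (//-rightDividesʳ y x) (+∈ p (-∈ q))

  unit-*-∈ : ∀ {u y} → IsUnit A u → UnitSpan y → UnitSpan (u * y)
  unit-*-∈ u (unit∈ v)    = unit∈ (isUnit-* u v)
  unit-*-∈ u (+∈ p q)     = resp (sym (distribˡ _ _ _)) (+∈ (unit-*-∈ u p) (unit-*-∈ u q))
  unit-*-∈ u (·∈ r p)     = resp (sym (·-*-assocʳ r _ _)) (·∈ r (unit-*-∈ u p))
  unit-*-∈ u (resp y≈z p) = resp (*-congˡ y≈z) (unit-*-∈ u p)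

  *-∈ : ∀ {x y} → UnitSpan x → UnitSpan y → UnitSpan (x * y)
  *-∈ (unit∈ u)    q = unit-*-∈ u q
  *-∈ (+∈ p p′)    q = resp (sym (distribʳ _ _ _)) (+∈ (*-∈ p q) (*-∈ p′ q))
  *-∈ (·∈ r p)     q = resp (sym (·-*-assocˡ r _ _)) (·∈ r (*-∈ p q))
  *-∈ (resp x≈z p) q = resp (*-congʳ x≈z) (*-∈ p q)

  geometric : Carrier → ℕ → Carrier
  geometric y zero    = 0#
  geometric y (suc k) = 1# + y * geometric y k

  commute-geometric : ∀ y k → Commute y (geometric y k)
  commute-geometric y zero    = commute-0ʳ y
  commute-geometric y (suc k) = commute-+ʳ (commute-1ʳ y) (commute-*ʳ refl (commute-geometric y k))

  geometric*[1-y]+yᵏ≈1 : ∀ y k → geometric y k * (1# - y) + y ^ k ≈ 1#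
  geometric*[1-y]+yᵏ≈1 y zero    = trans (+-congʳ (zeroˡ _)) (+-identityˡ 1#)
  geometric*[1-y]+yᵏ≈1 y (suc k) = begin
    (1# + y * G) * (1# - y) + y * y ^ k
      ≈⟨ +-congʳ (distribʳ (1# - y) 1# (y * G)) ⟩
    (1# * (1# - y) + y * G * (1# - y)) + y * y ^ k
      ≈⟨ +-assoc _ _ _ ⟩
    1# * (1# - y) + (y * G * (1# - y) + y * y ^ k)
      ≈⟨ +-cong (*-identityˡ _) (+-congʳ (*-assoc y G _)) ⟩
    (1# - y) + (y * (G * (1# - y)) + y * y ^ k)
      ≈⟨ +-congˡ (distribˡ y _ _) ⟨
    (1# - y) + y * (G * (1# - y) + y ^ k)
      ≈⟨ +-congˡ (*-congˡ (geometric*[1-y]+yᵏ≈1 y k)) ⟩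
    (1# - y) + y * 1#
      ≈⟨ +-congˡ (*-identityʳ y) ⟩
    (1# - y) + y
      ≈⟨ //-rightDividesˡ y 1# ⟩
    1# ∎
    where
    G : Carrier
    G = geometric y k

  nilpotent⇒1-isUnit : ∀ {y} k → y ^ k ≈ 0# → IsUnit A (1# - y)
  nilpotent⇒1-isUnit {y} k yᵏ≈0 = geometric y k , trans (sym commute) G[1-y]≈1 , G[1-y]≈1
    where
    G[1-y]≈1 : geometric y k * (1# - y) ≈ 1#
    G[1-y]≈1 = trans (sym (trans (+-congˡ yᵏ≈0) (+-identityʳ _))) (geometric*[1-y]+yᵏ≈1 y k)
    commute : Commute (geometric y k) (1# - y)
    commute = commute-+ʳ (commute-1ʳ _) (commute-‿ʳ (sym (commute-geometric y k)))

  nilpotent⇒∈UnitSpan : ∀ {y} k → y ^ k ≈ 0# → UnitSpan y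
  nilpotent⇒∈UnitSpan {y} k yᵏ≈0 =
    ∈-cancelʳ (resp 1≈y+[1-y] (unit∈ isUnit-1)) (unit∈ (nilpotent⇒1-isUnit k yᵏ≈0))
    where
    1≈y+[1-y] : 1# ≈ y + (1# - y)
    1≈y+[1-y] = sym (trans (+-comm y _) (//-rightDividesˡ y 1#))

  idempotent⇒¬¬∈UnitSpan : IsSimple A → ∀ {e} → e * e ≈ e → ¬ ¬ UnitSpan e
  idempotent⇒¬¬∈UnitSpan (_ , ideal-trivial) {e} e*e≈e = ¬¬-excluded-middle >>= λ
    { (yes f≈0) → return (resp (x∙y⁻¹≈ε⇒x≈y 1# e f≈0) (unit∈ isUnit-1))
    ; (no f≉0)  → return (resp e111e≈e
                           (ideal-trivial eAyAe⊆UnitSpan isIdeal (f , f∈ , f≉0) 1# 1# 1#)) }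
    where
    open Complement e*e≈e

    eAyAe⊆UnitSpan : Pred Carrier (c ⊔ ℓ ⊔ a ⊔ ℓa)
    eAyAe⊆UnitSpan y = ∀ p q → UnitSpan (e * p * y * q * e)

    isIdeal : IsIdeal A eAyAe⊆UnitSpan
    isIdeal = record
      { resp  = λ x≈y ∈I p q → resp (*-congʳ (*-congʳ (*-congˡ x≈y))) (∈I p q)
      ; zero∈ = λ p q → resp (sym (trans (*-congʳ (trans (*-congʳ (zeroʳ _)) (zeroˡ q))) (zeroˡ e))) 0∈
      ; +∈    = λ ∈I ∈J p q →
                  resp (sym (trans (*-congʳ (trans (*-congʳ (distribˡ _ _ _)) (distribʳ _ _ _)))
                                   (distribʳ _ _ _)))
                       (+∈ (∈I p q) (∈J p q))
      ; *ˡ∈   = λ r {y} ∈I p q →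
                  resp (*-congʳ (*-congʳ (trans (*-congʳ (sym (*-assoc e p r))) (*-assoc (e * p) r y))))
                       (∈I (p * r) q)
      ; *ʳ∈   = λ r {y} ∈I p q →
                  resp (*-congʳ (trans (sym (*-assoc _ r q)) (*-congʳ (*-assoc (e * p) y r))))
                       (∈I p (r * q))
      }

    f∈ : eAyAe⊆UnitSpan f
    f∈ p q = resp epf·fqe≈epfqe (*-∈ (nilpotent⇒∈UnitSpan 2 (xy≈0⇒[yx]²≈0 f·ep≈0))
                                       (nilpotent⇒∈UnitSpan 2 (xy≈0⇒[yx]²≈0 e·fq≈0)))
      where
      f·ep≈0 : f * (e * p) ≈ 0#
      f·ep≈0 = trans (sym (*-assoc f e p)) (trans (*-congʳ f*e≈0) (zeroˡ p))
      e·fq≈0 : e * (f * q) ≈ 0#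
      e·fq≈0 = trans (sym (*-assoc e f q)) (trans (*-congʳ e*f≈0) (zeroˡ q))
      epf·fqe≈epfqe : e * p * f * (f * q * e) ≈ e * p * f * q * e
      epf·fqe≈epfqe = begin
        e * p * f * (f * q * e)   ≈⟨ *-assoc _ (f * q) e ⟨
        e * p * f * (f * q) * e   ≈⟨ *-congʳ (*-assoc _ f q) ⟨
        e * p * f * f * q * e     ≈⟨ *-congʳ (*-congʳ (trans (*-assoc _ f f) (*-congˡ f*f≈f))) ⟩
        e * p * f * q * e         ∎

    e111e≈e : e * 1# * 1# * 1# * e ≈ e
    e111e≈e = trans (*-congʳ (trans (*-identityʳ _) (trans (*-identityʳ _) (*-identityʳ e)))) e*e≈e

  module Fitting {x b : Carrier} {k : ℕ} (x*b≈b*x : Commute x b) (xᵏ≈xᵏ⁺¹b : x ^ k ≈ x ^ suc k * b) where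

    e : Carrier
    e = x ^ k * b ^ k

    xb*xᵏ≈xᵏ : x * b * x ^ k ≈ x ^ k
    xb*xᵏ≈xᵏ = begin
      x * b * x ^ k     ≈⟨ *-assoc x b _ ⟩
      x * (b * x ^ k)   ≈⟨ *-congˡ (commute-^ʳ (sym x*b≈b*x) k) ⟩
      x * (x ^ k * b)   ≈⟨ *-assoc x _ b ⟨
      x ^ suc k * b     ≈⟨ xᵏ≈xᵏ⁺¹b ⟨
      x ^ k             ∎

    [xb]ʲ*xᵏ≈xᵏ : ∀ j → (x * b) ^ j * x ^ k ≈ x ^ k
    [xb]ʲ*xᵏ≈xᵏ zero    = *-identityˡ _
    [xb]ʲ*xᵏ≈xᵏ (suc j) = trans (*-assoc (x * b) _ _) (trans (*-congˡ ([xb]ʲ*xᵏ≈xᵏ j)) xb*xᵏ≈xᵏ)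

    e*xᵏ≈xᵏ : e * x ^ k ≈ x ^ k
    e*xᵏ≈xᵏ = trans (*-congʳ (sym (commute⇒^-distrib-* x*b≈b*x k))) ([xb]ʲ*xᵏ≈xᵏ k)

    e*e≈e : e * e ≈ e
    e*e≈e = trans (sym (*-assoc e _ _)) (*-congʳ e*xᵏ≈xᵏ)

    open Complement e*e≈e public

    commute-x-e : Commute x e
    commute-x-e = commute-*ʳ (commute-^ʳ refl k) (commute-^ʳ x*b≈b*x k)

    commute-b-e : Commute b e
    commute-b-e = commute-*ʳ (commute-^ʳ (sym x*b≈b*x) k) (commute-^ʳ refl k)

    xe+f-isUnit : IsUnit A (x * e + f)
    xe+f-isUnit = b * e + f
                , corner-inverse commute-x-e commute-b-e xbe≈e
                , corner-inverse commute-b-e commute-x-e (trans (*-congʳ (sym x*b≈b*x)) xbe≈e)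
      where
      xbe≈e : x * b * e ≈ e
      xbe≈e = trans (sym (*-assoc _ _ _)) (*-congʳ xb*xᵏ≈xᵏ)

    fx-nilpotent : (f * x) ^ suc k ≈ 0#
    fx-nilpotent = begin
      (f * x) ^ suc k       ≈⟨ commute⇒^-distrib-* (sym (commute-complement commute-x-e)) (suc k) ⟩
      f ^ suc k * x ^ suc k ≈⟨ *-cong (idempotent⇒^-suc f*f≈f k) (commute-^ʳ refl k) ⟩
      f * (x ^ k * x)       ≈⟨ *-assoc f _ x ⟨
      f * x ^ k * x         ≈⟨ *-congʳ f*xᵏ≈0 ⟩
      0# * x                ≈⟨ zeroˡ x ⟩
      0#                    ∎
      where
      f*xᵏ≈0 : f * x ^ k ≈ 0#
      f*xᵏ≈0 = trans ([y-z]x≈yx-zx _ 1# e)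
        (trans (+-cong (*-identityˡ _) (-‿cong e*xᵏ≈xᵏ)) (-‿inverseʳ _))

    xe+fx≈x : x * e + f * x ≈ x
    xe+fx≈x = begin
      x * e + f * x   ≈⟨ +-congˡ (commute-complement commute-x-e) ⟨
      x * e + x * f   ≈⟨ distribˡ x e f ⟨
      x * (e + f)     ≈⟨ *-congˡ e+f≈1 ⟩
      x * 1#          ≈⟨ *-identityʳ x ⟩
      x               ∎

  ¬¬-∈UnitSpan : FiniteDimensional A → IsSimple A → ∀ x → ¬ ¬ UnitSpan x
  ¬¬-∈UnitSpan finite simple x = do
    algebraic ← finiteDimensional⇒¬¬algebraic finite x
    (k , b , x*b≈b*x , xᵏ≈xᵏ⁺¹b) ← algebraic⇒¬¬stronglyπRegular algebraic
    let open Fitting {k = k} x*b≈b*x xᵏ≈xᵏ⁺¹b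
    f∈ ← idempotent⇒¬¬∈UnitSpan simple f*f≈f
    let xe∈ = ∈-cancelʳ (unit∈ xe+f-isUnit) f∈
        fx∈ = nilpotent⇒∈UnitSpan (suc k) fx-nilpotent
    return (resp xe+fx≈x (+∈ xe∈ fx∈))

lemma8 : {c ℓ a ℓa ℓh : Level} (F : Field c ℓ) (A : FAlgebra F a ℓa) →
    FiniteDimensional A → IsSimple A →
    (H : Pred (FAlgebra.Carrier A) ℓh) → IsSubspace A H → HasCodimOne A H →
    ¬ (∀ u → IsUnit A u → H u)
lemma8 F A finite simple H H-subspace (w , w∉H , _) units⊆H =
  ¬¬-∈UnitSpan A finite simple w (w∉H ∘ UnitSpan⊆ A H-subspace units⊆H)
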